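{- Let $P=\{S_1,\ldots,S_n\}$ be a homothetic packing of $n$ squares with contact graph $G=([n],E)$. If $K,K'$ are two distinct cliques of size $4$ in $G$, then $|K\cap K'|\le 2$.
   Context: Let $S=[-1,1]^2\subset\mathbb{R}^2$. A homothetic packing of $n$ squares is a set $\{S_1,\ldots,S_n\}$ with $S_i=r_iS+p_i$ ($r_i>0$, $p_i\in\mathbb{R}^2$) whose members have pairwise disjoint interiors. Its contact graph $G=([n],E)$ has $\{i,j\}\in E$ iff $i\ne j$ and $S_i\cap S_j\neq\emptyset$. -}

module Defs where

open import Level using (0ℓ)
open import Data.Nat using (ℕ)
open import Data.Fin using (Fin)
open import Data.Fin.Subset using (Subset; _∈_; ∣_∣)
open import Data.Product using (_×_; ∃; ∃-syntax)
open import Relation.Nullary using (¬_)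
open import Relation.Binary.PropositionalEquality using (_≡_)
open import Relation.Binary.Structures using (IsTotalOrder)
open import Algebra.Structures using (IsCommutativeRing)

-- The real numbers, axiomatised as a Dedekind-complete totally ordered
-- field (unique up to isomorphism).  Statements quantify over any model.
record RealField : Set₁ where
  infixl 6 _+_
  infixl 7 _*_
  infix  4 _≤_ _<_
  field
    Carrier : Set
    _+_ _*_ : Carrier → Carrier → Carrier
    -_      : Carrier → Carrier
    0# 1#   : Carrier
    _≤_     : Carrier → Carrier → Set
    isCommutativeRing : IsCommutativeRing _≡_ _+_ _*_ -_ 0# 1#
    0≢1     : ¬ (0# ≡ 1#)
    inverse : ∀ x → ¬ (x ≡ 0#) → ∃[ y ] (x * y ≡ 1#)
    isTotalOrder : IsTotalOrder _≡_ _≤_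
    +-mono-≤ : ∀ x y z → x ≤ y → x + z ≤ y + z
    *-nonneg : ∀ x y → 0# ≤ x → 0# ≤ y → 0# ≤ x * y
    complete : (P : Carrier → Set) → ∃[ x ] P x → ∃[ b ] (∀ x → P x → x ≤ b) →
               ∃[ s ] ((∀ x → P x → x ≤ s) × (∀ b → (∀ x → P x → x ≤ b) → s ≤ b))

  _<_ : Carrier → Carrier → Set
  x < y = (x ≤ y) × ¬ (x ≡ y)

  _-_ : Carrier → Carrier → Carrier
  x - y = x + (- y)

module _ (ℝ : RealField) where
  open RealField ℝ

  -- A family of n squares S_i = r_i S + p_i, S = [-1,1]^2, given by
  -- radii r_i and centres p_i = (px_i, py_i).
  record Squares (n : ℕ) : Set where
    field
      r  : Fin n → Carrier
      px : Fin n → Carrier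
      py : Fin n → Carrier

  module _ {n : ℕ} (P : Squares n) where
    open Squares P

    InSquare : Fin n → Carrier → Carrier → Set
    InSquare i x y = ((px i - r i ≤ x) × (x ≤ px i + r i))
                   × ((py i - r i ≤ y) × (y ≤ py i + r i))

    InInterior : Fin n → Carrier → Carrier → Set
    InInterior i x y = ((px i - r i < x) × (x < px i + r i))
                     × ((py i - r i < y) × (y < py i + r i))

    IsPacking : Set
    IsPacking = (∀ i → 0# < r i)
              × (∀ i j → ¬ (i ≡ j) → ∀ x y → ¬ (InInterior i x y × InInterior j x y))

    Contact : Fin n → Fin n → Set
    Contact i j = ¬ (i ≡ j) × ∃[ x ] ∃[ y ] (InSquare i x y × InSquare j x y)

    IsClique : Subset n → Set
    IsClique K = ∀ i j → i ∈ K → j ∈ K → ¬ (i ≡ j) → Contact i j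

-- Two distinct 4-cliques sharing three squares a, b, c give squares d, e with
-- a, b, c, d pairwise touching and e touching a, b, c.  Pairwise touching
-- squares have a common point p (take the largest left edge and the largest
-- bottom edge).  A square through p reaches into one of the four open quadrants
-- at p, and two squares reaching into the same quadrant have overlapping
-- interiors; so at most four squares of a packing pass through p, and at most
-- two of them reach into any given open half-plane at p.  If e passes through
-- p this is violated by a, b, c, d, e; otherwise e lies strictly on one side
-- of p, and a, b, c, which touch e, all reach into that side.
module Submission where

open import Defs
open import Level using (0ℓ)
open import Algebra.Bundles using (CommutativeRing)
open import Algebra.Structures using (IsCommutativeRing)
open import Data.Fin using (Fin; zero; suc; combine; _≟_)
open import Data.Fin.Properties using (any?; suc-injective; injective⇒≤; combine-injective)
open import Data.Fin.Subset using (Subset; _∩_; ∣_∣; _∈_; _∉_; _⊆_; inside; outside)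
open import Data.Fin.Subset.Properties using (_∈?_; _⊆?_; ⊆-antisym; p⊂q⇒∣p∣<∣q∣; x∈p∩q⁻)
open import Data.Empty using (⊥; ⊥-elim)
import Data.List.Extrema
open import Data.Nat.Base as ℕ using (ℕ; s≤s)
import Data.Nat.Properties as ℕₚ
open import Data.Product using (∃; _×_; _,_; proj₁; proj₂)
open import Data.Sum using (inj₁; inj₂)
open import Data.Vec using (Vec; []; _∷_; map; toList; here; there)
open import Data.Vec.Relation.Unary.All as All using (All; []; _∷_)
open import Data.Vec.Relation.Unary.All.Properties using (lookup⁺; toList⁺; toList⁻)
import Data.Vec.Relation.Unary.All.Properties as All
open import Data.Vec.Relation.Unary.AllPairs using ([]; _∷_)
open import Data.Vec.Relation.Unary.Unique.Propositional using (Unique)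
open import Data.Vec.Relation.Unary.Unique.Propositional.Properties using (lookup-injective)
import Data.Vec.Relation.Unary.Unique.Propositional.Properties as Unique
open import Function using (_∘_)
open import Relation.Binary.Bundles using (TotalOrder)
open import Relation.Binary.PropositionalEquality using (_≡_; _≢_; ≢-sym; refl; sym; trans; cong; cong₂; subst; subst₂; module ≡-Reasoning)
open import Relation.Binary.Structures using (IsTotalOrder)
open import Relation.Nullary using (¬_; yes; no; contradiction; ¬?)
open import Relation.Nullary.Decidable using (_×-dec_; decidable-stable)

module OrderedFieldProperties (ℝ : RealField) where
  open RealField ℝ
  open IsTotalOrder isTotalOrder using (total; antisym; reflexive) renaming (trans to ≤-trans)
  open IsCommutativeRing isCommutativeRing using
    (+-comm; +-assoc; +-identityˡ; +-identityʳ; -‿inverseˡ; -‿inverseʳ;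
     *-identityˡ; *-identityʳ; distribˡ; distribʳ)

  totalOrder : TotalOrder 0ℓ 0ℓ 0ℓ
  totalOrder = record { isTotalOrder = isTotalOrder }

  commutativeRing : CommutativeRing 0ℓ 0ℓ
  commutativeRing = record { isCommutativeRing = isCommutativeRing }

  open import Algebra.Properties.Ring (CommutativeRing.ring commutativeRing) using (-‿distribˡ-*; -‿distribʳ-*)
  open import Algebra.Properties.Group (CommutativeRing.+-group commutativeRing) using (⁻¹-involutive; x∙y⁻¹≈ε⇒x≈y; identityʳ-unique)

  ≤-<-trans : ∀ {x y z} → x ≤ y → y < z → x < z
  ≤-<-trans x≤y (y≤z , y≢z) = ≤-trans x≤y y≤z , λ { refl → y≢z (antisym y≤z x≤y) }

  <-≤-trans : ∀ {x y z} → x < y → y ≤ z → x < z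
  <-≤-trans (x≤y , x≢y) y≤z = ≤-trans x≤y y≤z , λ { refl → x≢y (antisym x≤y y≤z) }

  ≰⇒> : ∀ {x y} → ¬ x ≤ y → y < x
  ≰⇒> {x} {y} x≰y with total x y
  ... | inj₁ x≤y = contradiction x≤y x≰y
  ... | inj₂ y≤x = y≤x , λ y≡x → x≰y (reflexive (sym y≡x))

  +-monoʳ-≤ : ∀ z {x y} → x ≤ y → z + x ≤ z + y
  +-monoʳ-≤ z {x} {y} x≤y = subst₂ _≤_ (+-comm x z) (+-comm y z) (+-mono-≤ x y z x≤y)

  [x-y]+y≡x : ∀ x y → (x - y) + y ≡ x
  [x-y]+y≡x x y = trans (+-assoc x (- y) y) (trans (cong (x +_) (-‿inverseˡ y)) (+-identityʳ x))

  x≤x+y : ∀ {x y} → 0# ≤ y → x ≤ x + y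
  x≤x+y {x} {y} 0≤y = subst (_≤ x + y) (+-identityʳ x) (+-monoʳ-≤ x 0≤y)

  x<x+y : ∀ {x y} → 0# < y → x < x + y
  x<x+y {x} {y} (0≤y , 0≢y) = x≤x+y 0≤y , λ x≡x+y → 0≢y (sym (identityʳ-unique x y (sym x≡x+y)))

  x-y<x : ∀ {x y} → 0# < y → x - y < x
  x-y<x {x} {y} 0<y = subst (x - y <_) ([x-y]+y≡x x y) (x<x+y 0<y)

  x≤0⇒0≤-x : ∀ {x} → x ≤ 0# → 0# ≤ - x
  x≤0⇒0≤-x {x} x≤0 = subst₂ _≤_ (-‿inverseʳ x) (+-identityˡ (- x)) (+-mono-≤ x 0# (- x) x≤0)

  -x*-x≡x*x : ∀ x → - x * - x ≡ x * x
  -x*-x≡x*x x = begin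
    - x * - x      ≡⟨ sym (-‿distribˡ-* x (- x)) ⟩
    - (x * - x)    ≡⟨ cong -_ (sym (-‿distribʳ-* x x)) ⟩
    - (- (x * x))  ≡⟨ ⁻¹-involutive (x * x) ⟩
    x * x          ∎
    where open ≡-Reasoning

  0≤x*x : ∀ x → 0# ≤ x * x
  0≤x*x x with total 0# x
  ... | inj₁ 0≤x = *-nonneg x x 0≤x 0≤x
  ... | inj₂ x≤0 = subst (0# ≤_) (-x*-x≡x*x x) (*-nonneg (- x) (- x) 0≤-x 0≤-x)
    where 0≤-x = x≤0⇒0≤-x x≤0

  0<1 : 0# < 1#
  0<1 = subst (0# ≤_) (*-identityʳ 1#) (0≤x*x 1#) , 0≢1

  0<2 : 0# < 1# + 1#
  0<2 = ≤-<-trans (proj₁ 0<1) (x<x+y 0<1)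

  1+1≢0 : ¬ (1# + 1# ≡ 0#)
  1+1≢0 1+1≡0 = proj₂ 0<2 (sym 1+1≡0)

  half : Carrier
  half = proj₁ (inverse (1# + 1#) 1+1≢0)

  half+half≡1 : half + half ≡ 1#
  half+half≡1 = begin
    half + half            ≡⟨ cong₂ _+_ (sym (*-identityˡ half)) (sym (*-identityˡ half)) ⟩
    1# * half + 1# * half  ≡⟨ sym (distribʳ half 1# 1#) ⟩
    (1# + 1#) * half       ≡⟨ proj₂ (inverse (1# + 1#) 1+1≢0) ⟩
    1#                     ∎
    where open ≡-Reasoning

  x*half+x*half≡x : ∀ x → x * half + x * half ≡ x
  x*half+x*half≡x x = trans (sym (distribˡ x half half)) (trans (cong (x *_) half+half≡1) (*-identityʳ x))

  -- half = half² + half² is a sum of squares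
  0≤half : 0# ≤ half
  0≤half = subst (0# ≤_) (x*half+x*half≡x half)
    (≤-trans (0≤x*x half) (x≤x+y (0≤x*x half)))

  <-dense : ∀ {x y} → x < y → ∃ λ z → x < z × z < y
  <-dense {x} {y} (x≤y , x≢y) = x + t , x<x+y 0<t , subst (x + t <_) x+t+t≡y (x<x+y 0<t)
    where
    d = y - x
    t = d * half
    0≤d : 0# ≤ d
    0≤d = subst (_≤ d) (-‿inverseʳ x) (+-mono-≤ x y (- x) x≤y)
    0<t : 0# < t
    0<t = *-nonneg d half 0≤d 0≤half , λ 0≡t → x≢y (sym (x∙y⁻¹≈ε⇒x≈y y x (begin
      d          ≡⟨ sym (x*half+x*half≡x d) ⟩
      t + t      ≡⟨ cong₂ _+_ (sym 0≡t) (sym 0≡t) ⟩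
      0# + 0#    ≡⟨ +-identityˡ 0# ⟩
      0#         ∎)))
      where open ≡-Reasoning
    x+t+t≡y : x + t + t ≡ y
    x+t+t≡y = begin
      x + t + t    ≡⟨ +-assoc x t t ⟩
      x + (t + t)  ≡⟨ cong (x +_) (x*half+x*half≡x d) ⟩
      x + (y - x)  ≡⟨ +-comm x d ⟩
      (y - x) + x  ≡⟨ [x-y]+y≡x y x ⟩
      y            ∎
      where open ≡-Reasoning

  between₂ : ∀ {a₁ a₂ b₁ b₂} → a₁ < b₁ → a₁ < b₂ → a₂ < b₁ → a₂ < b₂ →
             ∃ λ z → (a₁ < z × z < b₁) × (a₂ < z × z < b₂)
  between₂ {a₁} {a₂} {b₁} {b₂} a₁<b₁ a₁<b₂ a₂<b₁ a₂<b₂ with total a₁ a₂ | total b₁ b₂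
  ... | inj₁ a₁≤a₂ | inj₁ b₁≤b₂ with z , a₂<z , z<b₁ ← <-dense a₂<b₁ =
    z , (≤-<-trans a₁≤a₂ a₂<z , z<b₁) , (a₂<z , <-≤-trans z<b₁ b₁≤b₂)
  ... | inj₁ a₁≤a₂ | inj₂ b₂≤b₁ with z , a₂<z , z<b₂ ← <-dense a₂<b₂ =
    z , (≤-<-trans a₁≤a₂ a₂<z , <-≤-trans z<b₂ b₂≤b₁) , (a₂<z , z<b₂)
  ... | inj₂ a₂≤a₁ | inj₁ b₁≤b₂ with z , a₁<z , z<b₁ ← <-dense a₁<b₁ =
    z , (a₁<z , z<b₁) , (≤-<-trans a₂≤a₁ a₁<z , <-≤-trans z<b₁ b₁≤b₂)
  ... | inj₂ a₂≤a₁ | inj₂ b₂≤b₁ with z , a₁<z , z<b₂ ← <-dense a₁<b₂ =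
    z , (a₁<z , <-≤-trans z<b₂ b₂≤b₁) , (≤-<-trans a₂≤a₁ a₁<z , z<b₂)

⊈-witness : ∀ {n} {p q : Subset n} → ¬ p ⊆ q → ∃ λ x → x ∈ p × x ∉ q
⊈-witness {p = p} {q} p⊈q with any? (λ x → x ∈? p ×-dec ¬? (x ∈? q))
... | yes witness = witness
... | no none = contradiction (λ {x} x∈p → decidable-stable (x ∈? q) λ x∉q → none (x , x∈p , x∉q)) p⊈q

⊆∧∣p∣≡∣q∣⇒≡ : ∀ {n} {p q : Subset n} → p ⊆ q → ∣ p ∣ ≡ ∣ q ∣ → p ≡ q
⊆∧∣p∣≡∣q∣⇒≡ {p = p} {q} p⊆q ∣p∣≡∣q∣ = ⊆-antisym p⊆q (decidable-stable (q ⊆? p) λ q⊈p →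
  ℕₚ.<-irrefl ∣p∣≡∣q∣ (p⊂q⇒∣p∣<∣q∣ (p⊆q , ⊈-witness q⊈p)))

distinct-members : ∀ {n k} (p : Subset n) → k ℕ.≤ ∣ p ∣ → ∃ λ (v : Vec (Fin n) k) → Unique v × All (_∈ p) v
distinct-members {k = ℕ.zero} p _ = [] , [] , []
distinct-members (outside ∷ p) k≤∣p∣ with v , unique , v⊆p ← distinct-members p k≤∣p∣ =
  map suc v , Unique.map⁺ suc-injective unique , All.map⁺ (All.map there v⊆p)
distinct-members {k = ℕ.suc k} (inside ∷ p) (s≤s k≤∣p∣) with v , unique , v⊆p ← distinct-members p k≤∣p∣ =
  zero ∷ map suc v , All.map⁺ (All.universal (λ _ ()) v) ∷ Unique.map⁺ suc-injective unique ,
  here ∷ All.map⁺ (All.map there v⊆p)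

∉⇒≢ : ∀ {n} {p : Subset n} {x y} → x ∉ p → y ∈ p → x ≢ y
∉⇒≢ {p = p} x∉p y∈p refl = x∉p y∈p

injectiveOn⇒≤ : ∀ {a ℓ} {A : Set a} {P : A → Set ℓ} {m k} (colour : A → Fin m) →
                (∀ {x y} → P x → P y → colour x ≡ colour y → x ≡ y) →
                {v : Vec A k} → Unique v → All P v → k ℕ.≤ m
injectiveOn⇒≤ colour injective unique pv =
  injective⇒≤ λ {i} {j} eq → lookup-injective unique i j (injective (lookup⁺ pv i) (lookup⁺ pv j) eq)


module SquarePacking (ℝ : RealField) {n : ℕ} (P : Squares ℝ n) (packing : IsPacking ℝ P) where
  open RealField ℝ
  open Squares P
  open OrderedFieldProperties ℝ
  open IsTotalOrder isTotalOrder using (total) renaming (trans to ≤-trans)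
  open Data.List.Extrema totalOrder using (argmax; argmax-all; f[⊥]≤f[argmax]; f[xs]≤f[argmax])

  data Axis : Set where
    horizontal vertical : Axis

  other : Axis → Axis
  other horizontal = vertical
  other vertical   = horizontal

  centre : Axis → Fin n → Carrier
  centre horizontal = px
  centre vertical   = py

  lower upper : Axis → Fin n → Carrier
  lower α i = centre α i - r i
  upper α i = centre α i + r i

  lower<centre : ∀ α i → lower α i < centre α i
  lower<centre α i = x-y<x (proj₁ packing i)

  centre<upper : ∀ α i → centre α i < upper α i
  centre<upper α i = x<x+y (proj₁ packing i)

  lower<upper : ∀ α i → lower α i < upper α i
  lower<upper α i = ≤-<-trans (proj₁ (lower<centre α i)) (centre<upper α i)

  Point : Set
  Point = Axis → Carrier

  Contains : Point → Fin n → Set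
  Contains p i = ∀ α → lower α i ≤ p α × p α ≤ upper α i

  data Side : Set where
    below above : Side

  -- Along α, square i contains points on side σ of p arbitrarily close to p.
  Occupies : Axis → Side → Point → Fin n → Set
  Occupies α below p i = lower α i < p α × p α ≤ upper α i
  Occupies α above p i = lower α i ≤ p α × p α < upper α i

  Beside : Axis → Side → Point → Fin n → Set
  Beside α below p i = upper α i < p α
  Beside α above p i = p α < lower α i

  -- Equality of reals is undecidable, so rather than asking whether p lies on
  -- an edge we compare p with the centre.
  side : Axis → Point → Fin n → Side
  side α p i with total (p α) (centre α i)
  ... | inj₁ _ = above
  ... | inj₂ _ = below

  occupies-side : ∀ {p i} α → Contains p i → Occupies α (side α p i) p i
  occupies-side {p} {i} α p∈i with total (p α) (centre α i) | p∈i α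
  ... | inj₁ p≤c | lo≤p , _    = lo≤p , ≤-<-trans p≤c (centre<upper α i)
  ... | inj₂ c≤p | _    , p≤hi = <-≤-trans (lower<centre α i) c≤p , p≤hi

  InteriorsMeetAlong : Axis → Fin n → Fin n → Set
  InteriorsMeetAlong α i j = ∃ λ z → (lower α i < z × z < upper α i) × (lower α j < z × z < upper α j)

  interiors-meet⇒≡ : ∀ {i j} α → InteriorsMeetAlong α i j → InteriorsMeetAlong (other α) i j → i ≡ j
  interiors-meet⇒≡ {i} {j} horizontal (x , xi , xj) (y , yi , yj) =
    decidable-stable (i ≟ j) λ i≢j → proj₂ packing i j i≢j x y ((xi , yi) , (xj , yj))
  interiors-meet⇒≡ vertical y-meet x-meet = interiors-meet⇒≡ horizontal x-meet y-meet

  same-side⇒meet : ∀ {α σ p i j} → Occupies α σ p i → Occupies α σ p j → InteriorsMeetAlong α i j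
  same-side⇒meet {σ = below} (li<p , p≤ui) (lj<p , p≤uj) =
    between₂ (<-≤-trans li<p p≤ui) (<-≤-trans li<p p≤uj) (<-≤-trans lj<p p≤ui) (<-≤-trans lj<p p≤uj)
  same-side⇒meet {σ = above} (li≤p , p<ui) (lj≤p , p<uj) =
    between₂ (≤-<-trans li≤p p<ui) (≤-<-trans li≤p p<uj) (≤-<-trans lj≤p p<ui) (≤-<-trans lj≤p p<uj)

  same-side-index⇒meet : ∀ {α p i j} → Contains p i → Contains p j →
                          side α p i ≡ side α p j → InteriorsMeetAlong α i j
  same-side-index⇒meet {α} p∈i p∈j eq =
    same-side⇒meet (occupies-side α p∈i) (subst (λ σ → Occupies α σ _ _) (sym eq) (occupies-side α p∈j))

  sideIndex : Side → Fin 2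
  sideIndex below = zero
  sideIndex above = suc zero

  sideIndex-injective : ∀ {σ τ} → sideIndex σ ≡ sideIndex τ → σ ≡ τ
  sideIndex-injective {below} {below} _ = refl
  sideIndex-injective {above} {above} _ = refl

  at-most-four-through-a-point : ∀ {p k} {v : Vec (Fin n) k} → Unique v → All (Contains p) v → k ℕ.≤ 4
  at-most-four-through-a-point {p} = injectiveOn⇒≤ quadrant λ p∈i p∈j eq →
    let sx , sy = combine-injective _ _ _ _ eq in
    interiors-meet⇒≡ horizontal (same-side-index⇒meet p∈i p∈j (sideIndex-injective sx))
                                (same-side-index⇒meet p∈i p∈j (sideIndex-injective sy))
    where
    quadrant : Fin n → Fin 4
    quadrant i = combine (sideIndex (side horizontal p i)) (sideIndex (side vertical p i))

  at-most-two-occupy-a-side : ∀ {p k} α σ {v : Vec (Fin n) k} →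
                              Unique v → All (λ i → Contains p i × Occupies α σ p i) v → k ℕ.≤ 2
  at-most-two-occupy-a-side {p} α σ = injectiveOn⇒≤ (λ i → sideIndex (side (other α) p i))
    λ (p∈i , i-occ) (p∈j , j-occ) eq →
      interiors-meet⇒≡ α (same-side⇒meet i-occ j-occ) (same-side-index⇒meet p∈i p∈j (sideIndex-injective eq))

  contact-sym : ∀ {i j} → Contact ℝ P i j → Contact ℝ P j i
  contact-sym (i≢j , x , y , i∋xy , j∋xy) = i≢j ∘ sym , x , y , j∋xy , i∋xy

  contact⇒lower≤upper : ∀ {i j} → Contact ℝ P i j → ∀ α → lower α i ≤ upper α j
  contact⇒lower≤upper (_ , _ , _ , ((lo≤x , _) , _) , ((_ , x≤hi) , _)) horizontal = ≤-trans lo≤x x≤hi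
  contact⇒lower≤upper (_ , _ , _ , (_ , (lo≤y , _)) , (_ , (_ , y≤hi))) vertical   = ≤-trans lo≤y y≤hi

  touching-beside⇒occupies : ∀ {α σ p e i} → Beside α σ p e → Contact ℝ P e i → Contains p i → Occupies α σ p i
  touching-beside⇒occupies {α} {below} e<p e~i p∈i =
    ≤-<-trans (contact⇒lower≤upper (contact-sym e~i) α) e<p , proj₂ (p∈i α)
  touching-beside⇒occupies {α} {above} p<e e~i p∈i =
    proj₁ (p∈i α) , <-≤-trans p<e (contact⇒lower≤upper e~i α)

  contains-unless-beside : ∀ p e → (∀ α σ → ¬ Beside α σ p e) → ¬ ¬ Contains p e
  contains-unless-beside p e not-beside ¬p∈e =
    within horizontal λ x-within → within vertical λ y-within →
      ¬p∈e λ { horizontal → x-within ; vertical → y-within }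
    where
    within : ∀ α → ¬ ¬ (lower α e ≤ p α × p α ≤ upper α e)
    within α ¬within = not-beside α above (≰⇒> λ lo≤p → not-beside α below (≰⇒> λ p≤hi → ¬within (lo≤p , p≤hi)))

  clique-meets : ∀ {K i j} → IsClique ℝ P K → i ∈ K → j ∈ K → ∀ α → lower α i ≤ upper α j
  clique-meets {i = i} {j} clique i∈K j∈K α with i ≟ j
  ... | yes refl = proj₁ (lower<upper α i)
  ... | no i≢j = contact⇒lower≤upper (clique i j i∈K j∈K i≢j) α

  clique-common-point : ∀ {K k} → IsClique ℝ P K → (v : Vec (Fin n) (ℕ.suc k)) → All (_∈ K) v →
                        ∃ λ p → All (Contains p) v
  clique-common-point {K} clique (i ∷ is) v⊆K@(i∈K ∷ is⊆K) =
    p , All.map (λ (x-within , y-within) → λ { horizontal → x-within ; vertical → y-within })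
                (All.zip (within horizontal , within vertical))
    where
    maxLower : Axis → Fin n
    maxLower α = argmax (lower α) i (toList is)

    p : Point
    p α = lower α (maxLower α)

    below-p : ∀ α → All (λ j → lower α j ≤ p α) (i ∷ is)
    below-p α = f[⊥]≤f[argmax] {f = lower α} i (toList is) ∷ toList⁻ (f[xs]≤f[argmax] {f = lower α} i (toList is))

    within : ∀ α → All (λ j → lower α j ≤ p α × p α ≤ upper α j) (i ∷ is)
    within α = All.map (λ (lo≤p , j∈K) → lo≤p , clique-meets clique (argmax-all (lower α) i∈K (toList⁺ is⊆K)) j∈K α)
                       (All.zip (below-p α , v⊆K))

  no-square-touches-three-of-four-through-a-point :
    ∀ {p d e} (v : Vec (Fin n) 3) → Unique (d ∷ e ∷ v) → All (Contains p) (d ∷ v) → All (Contact ℝ P e) v → ⊥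
  no-square-touches-three-of-four-through-a-point {p} {d} {e} v unique@(_ ∷ _ ∷ v-unique) (p∈d ∷ p∈v) e~v =
    contains-unless-beside p e
      (λ α σ e-beside → ℕₚ.1+n≰n (at-most-two-occupy-a-side α σ v-unique
        (All.map (λ (p∈i , e~i) → p∈i , touching-beside⇒occupies e-beside e~i p∈i) (All.zip (p∈v , e~v)))))
      (λ p∈e → ℕₚ.1+n≰n (at-most-four-through-a-point unique (p∈d ∷ p∈e ∷ p∈v)))

  no-two-K₄-share-a-triangle : ∀ {K K′ d e} → IsClique ℝ P K → IsClique ℝ P K′ →
                               (v : Vec (Fin n) 3) → Unique v → All (_∈ K ∩ K′) v →
                               d ∈ K → d ∉ K′ → e ∈ K′ → e ∉ K → ⊥
  no-two-K₄-share-a-triangle {K} {K′} {d} {e} K-clique K′-clique v v-unique v⊆K∩K′ d∈K d∉K′ e∈K′ e∉K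
    with v⊆K , v⊆K′ ← All.unzip (All.map (x∈p∩q⁻ K K′) v⊆K∩K′)
    with p , p∈d ∷ p∈v ← clique-common-point K-clique (d ∷ v) (d∈K ∷ v⊆K)
    = no-square-touches-three-of-four-through-a-point v
        ((≢-sym (∉⇒≢ e∉K d∈K) ∷ All.map (∉⇒≢ d∉K′) v⊆K′) ∷ All.map (∉⇒≢ e∉K) v⊆K ∷ v-unique)
        (p∈d ∷ p∈v)
        (All.map (λ (x∈K , x∈K′) → K′-clique e _ e∈K′ x∈K′ (∉⇒≢ e∉K x∈K)) (All.zip (v⊆K , v⊆K′)))

lemma9 : (ℝ : RealField) (n : ℕ) (P : Squares ℝ n) → IsPacking ℝ P →
         (K K′ : Subset n) → IsClique ℝ P K → ∣ K ∣ ≡ 4 →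
         IsClique ℝ P K′ → ∣ K′ ∣ ≡ 4 → ¬ (K ≡ K′) →
         ∣ K ∩ K′ ∣ ℕ.≤ 2
lemma9 ℝ n P packing K K′ K-clique ∣K∣≡4 K′-clique ∣K′∣≡4 K≢K′ with ∣ K ∩ K′ ∣ ℕₚ.≤? 2
... | yes ∣K∩K′∣≤2 = ∣K∩K′∣≤2
... | no ∣K∩K′∣≰2
  with v , v-unique , v⊆K∩K′ ← distinct-members (K ∩ K′) (ℕₚ.≰⇒> ∣K∩K′∣≰2)
  with d , d∈K , d∉K′ ← ⊈-witness (λ K⊆K′ → K≢K′ (⊆∧∣p∣≡∣q∣⇒≡ K⊆K′ (trans ∣K∣≡4 (sym ∣K′∣≡4))))
  with e , e∈K′ , e∉K ← ⊈-witness (λ K′⊆K → K≢K′ (sym (⊆∧∣p∣≡∣q∣⇒≡ K′⊆K (trans ∣K′∣≡4 (sym ∣K∣≡4)))))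
  = ⊥-elim (no-two-K₄-share-a-triangle K-clique K′-clique v v-unique v⊆K∩K′ d∈K d∉K′ e∈K′ e∉K)
  where open SquarePacking ℝ P packing
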